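{- Let $G=(V,E)$ be a finite simple graph with $n=|V|$, $\Sigma$ a finite alphabet, $\chi\colon V\to\Sigma$ a coloring and $\mathcal{D}\subseteq\Sigma^2$. Let $H=(V,A)$ be the directed graph in which, for distinct $u,v\in V$, $(u,v)\in A$ if and only if either ($\{u,v\}\in E$ and $\chi(v)\chi(u)\notin\mathcal{D}$) or ($\{u,v\}\notin E$ and $\chi(v)\chi(u)\in\mathcal{D}$). Then a permutation $\pi(1),\dots,\pi(n)$ of $V$ is a topological ordering of $H$ if and only if for all $1\le i<j\le n$: $\{\pi(i),\pi(j)\}\in E$ if and only if $\chi(\pi(i))\chi(\pi(j))\in\mathcal{D}$ (equivalently, $\pi(i)\mapsto i$ is an isomorphism from $G$ to the letter graph $G(\mathcal{D},\chi(\pi(1))\cdots\chi(\pi(n)))$ respecting the coloring $\chi$).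
   Context: For a decoder $\mathcal{D}\subseteq\Sigma^2$ and word $w=w_1\cdots w_n$, the letter graph $G(\mathcal{D},w)$ has vertex set $\{1,\dots,n\}$ and edges $\{i,j\}$ for $i<j$ with $w_iw_j\in\mathcal{D}$. A topological ordering of a directed graph $(V,A)$ is a permutation of $V$ such that $(v,u)\notin A$ whenever $u$ precedes $v$. An isomorphism $f$ from $G$ to $G(\mathcal{D},w)$ respects $\chi$ if $w_{f(v)}=\chi(v)$ for all $v$. -}

module Defs where

open import Data.Nat using (ℕ)
open import Data.Fin using (Fin; _<_)
open import Data.Fin.Permutation using (Permutation′; _⟨$⟩ʳ_)
open import Data.Product using (_×_)
open import Data.Sum using (_⊎_)
open import Relation.Nullary using (¬_)
open import Relation.Binary using (Rel; Decidable; Symmetric; Irreflexive)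
open import Relation.Binary.PropositionalEquality using (_≡_)
open import Function.Bundles using (_⇔_)
open import Level using (0ℓ)

record SimpleGraph (n : ℕ) : Set₁ where
  field
    Adj     : Rel (Fin n) 0ℓ
    adj?    : Decidable Adj
    sym     : Symmetric Adj
    irrefl  : Irreflexive _≡_ Adj

Arc : ∀ {n} {Σ : Set} → SimpleGraph n → (Fin n → Σ) → Rel Σ 0ℓ →
      Fin n → Fin n → Set
Arc G χ D u v =
  ¬ (u ≡ v) ×
  ((SimpleGraph.Adj G u v × ¬ D (χ v) (χ u)) ⊎
   (¬ SimpleGraph.Adj G u v × D (χ v) (χ u)))

IsTopologicalOrdering : ∀ {n} → (Fin n → Fin n → Set) → Permutation′ n → Set
IsTopologicalOrdering {n} A π =
  ∀ (i j : Fin n) → i < j → ¬ A (π ⟨$⟩ʳ j) (π ⟨$⟩ʳ i)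

-- Between distinct vertices, an arc v → u of H says precisely that adjacency of u, v and
-- membership of χ(u)χ(v) in D disagree.  Excluding every backward arc of the ordering is
-- therefore excluding every such disagreement, which for decidable relations is agreement.
module Submission where

open import Defs
open import Data.Fin using (Fin; _<_)
open import Data.Fin.Permutation using (Permutation′; _⟨$⟩ʳ_)
open import Data.Fin.Properties using (<⇒≢)
open import Data.Nat using (ℕ)
open import Data.Product using (_×_; _,_; map₁)
open import Data.Sum using (_⊎_; inj₁; inj₂; map)
open import Function using (_∘_)
open import Function.Bundles using (_⇔_; _↔_; mk⇔; Equivalence; Injection)
open import Function.Properties.Inverse using (↔⇒↣)
open import Level using (0ℓ)
open import Relation.Binary using (Rel; Decidable)
open import Relation.Binary.PropositionalEquality using (_≢_; ≢-sym)
open import Relation.Nullary using (Dec; ¬_)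
open import Relation.Nullary.Decidable using (decidable-stable)

Disagree : Set → Set → Set
Disagree P Q = (P × ¬ Q) ⊎ (¬ P × Q)

Disagree-mapˡ : {P P′ Q : Set} → (P → P′) → (P′ → P) → Disagree P Q → Disagree P′ Q
Disagree-mapˡ f g = map (map₁ f) (map₁ (_∘ g))

¬Disagree⇔agree : {P Q : Set} → Dec P → Dec Q → (¬ Disagree P Q) ⇔ (P ⇔ Q)
¬Disagree⇔agree {P} {Q} P? Q? = mk⇔ agree consistent
  where
  agree : ¬ Disagree P Q → P ⇔ Q
  agree ¬dis = mk⇔ (λ p → decidable-stable Q? (λ ¬q → ¬dis (inj₁ (p , ¬q))))
                   (λ q → decidable-stable P? (λ ¬p → ¬dis (inj₂ (¬p , q))))

  consistent : P ⇔ Q → ¬ Disagree P Q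
  consistent P⇔Q (inj₁ (p , ¬q)) = ¬q (Equivalence.to P⇔Q p)
  consistent P⇔Q (inj₂ (¬p , q)) = ¬p (Equivalence.from P⇔Q q)

permutation-<⇒≢ : ∀ {n} (π : Permutation′ n) {i j : Fin n} →
                  i < j → π ⟨$⟩ʳ i ≢ π ⟨$⟩ʳ j
permutation-<⇒≢ π i<j = <⇒≢ i<j ∘ Injection.injective (↔⇒↣ π)

module _ {n} (G : SimpleGraph n) {Σ : Set} (χ : Fin n → Σ)
         {D : Rel Σ 0ℓ} (D? : Decidable D) where

  open SimpleGraph G

  ¬Arc⇔[Adj⇔D] : ∀ {u v} → u ≢ v → (¬ Arc G χ D v u) ⇔ (Adj u v ⇔ D (χ u) (χ v))
  ¬Arc⇔[Adj⇔D] {u} {v} u≢v = mk⇔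
    (λ ¬arc → to (λ dis → ¬arc (≢-sym u≢v , Disagree-mapˡ sym sym dis)))
    (λ agree → λ { (_ , dis) → from agree (Disagree-mapˡ sym sym dis) })
    where open Equivalence (¬Disagree⇔agree (adj? u v) (D? (χ u) (χ v)))

lemma1 : (n : ℕ) (G : SimpleGraph n) (Σ' : Set) (k : ℕ) (finΣ : Σ' ↔ Fin k)
         (χ : Fin n → Σ') (D : Rel Σ' 0ℓ) (D? : Decidable D)
         (π : Permutation′ n) →
         IsTopologicalOrdering (Arc G χ D) π
         ⇔ (∀ (i j : Fin n) → i < j →
              SimpleGraph.Adj G (π ⟨$⟩ʳ i) (π ⟨$⟩ʳ j)
              ⇔ D (χ (π ⟨$⟩ʳ i)) (χ (π ⟨$⟩ʳ j)))
lemma1 n G Σ' k finΣ χ D D? π = mk⇔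
  (λ topological i j i<j → Equivalence.to (noArc⇔agree i<j) (topological i j i<j))
  (λ agreeing i j i<j → Equivalence.from (noArc⇔agree i<j) (agreeing i j i<j))
  where
  open SimpleGraph G using (Adj)
  noArc⇔agree : ∀ {i j} → i < j →
                (¬ Arc G χ D (π ⟨$⟩ʳ j) (π ⟨$⟩ʳ i))
                ⇔ (Adj (π ⟨$⟩ʳ i) (π ⟨$⟩ʳ j) ⇔ D (χ (π ⟨$⟩ʳ i)) (χ (π ⟨$⟩ʳ j)))
  noArc⇔agree i<j = ¬Arc⇔[Adj⇔D] G χ D? (permutation-<⇒≢ π i<j)
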